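{- For every monoid $(M,\bullet)$, the set $\mathsf{T}M$ equipped with the partial compositions $\circ_i$ and the symmetric group actions defined below is a set-operad (a symmetric operad in the category of sets), and for every monoid morphism $\theta : M \to N$ the map $\mathsf{T}\theta : \mathsf{T}M \to \mathsf{T}N$ is a morphism of set-operads. The assignment $M \mapsto \mathsf{T}M$, $\theta \mapsto \mathsf{T}\theta$ is a functor from the category of monoids (with monoid morphisms) to the category of set-operads (with morphisms of set-operads). Moreover, $\mathsf{T}$ respects injections and surjections: if $\theta$ is injective (resp. surjective), then $\mathsf{T}\theta$ is injective (resp. surjective).
   Context: For a monoid $(M,\bullet)$ with identity $e$, let $\mathsf{T}M := \biguplus_{n\ge 1} \mathsf{T}M(n)$, where $\mathsf{T}M(n) := M^n$ is the set of words $(x_1,\dots,x_n)$ of length $n$ over $M$ (the elements of arity $n$). The partial compositions $\circ_i : \mathsf{T}M(n)\times \mathsf{T}M(m)\to \mathsf{T}M(n+m-1)$, for $n,m\ge1$ and $1\le i\le n$, are defined by $x\circ_i y := (x_1,\dots,x_{i-1},\, x_i\bullet y_1,\dots,x_i\bullet y_m,\, x_{i+1},\dots,x_n)$. The right action of the symmetric group $\mathfrak{S}_n$ on $\mathsf{T}M(n)$ is defined by $x\cdot\sigma := (x_{\sigma_1},\dots,x_{\sigma_n})$. For a monoid morphism $\theta : M\to N$, $\mathsf{T}\theta(x_1,\dots,x_n) := (\theta(x_1),\dots,\theta(x_n))$. -}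

module Defs where

open import Level using (0ℓ)
open import Data.Nat using (ℕ; zero; suc; _+_)
open import Data.Nat.Properties using (+-assoc; +-comm; +-identityʳ)
open import Data.Fin as Fin using (Fin; zero; suc; _<_; _↑ˡ_; _↑ʳ_)
open import Data.Fin.Permutation using (Permutation′; _⟨$⟩ʳ_; _∘ₚ_)
import Data.Fin.Permutation as Perm
open import Data.Vec as Vec using (Vec; []; _∷_; _++_; lookup; tabulate)
open import Data.Product using (_×_)
open import Relation.Binary.PropositionalEquality
  using (_≡_; _≢_; refl; sym; trans; cong; subst)
open import Algebra.Core using (Op₂)
open import Algebra.Structures using (IsMonoid)
open import Algebra.Bundles.Raw using (RawMonoid)
open import Algebra.Morphism.Structures using (module MonoidMorphisms)

record SetMonoid : Set₁ where
  field
    Carrier  : Set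
    _∙_      : Op₂ Carrier
    ε        : Carrier
    isMonoid : IsMonoid _≡_ _∙_ ε

  rawMonoid : RawMonoid 0ℓ 0ℓ
  rawMonoid = record { Carrier = Carrier ; _≈_ = _≡_ ; _∙_ = _∙_ ; ε = ε }

open SetMonoid using (Carrier; rawMonoid)

IsMonoidMorphism : (M N : SetMonoid) → (Carrier M → Carrier N) → Set
IsMonoidMorphism M N θ =
  MonoidMorphisms.IsMonoidHomomorphism (rawMonoid M) (rawMonoid N) θ

-- Positions inside a partial composition x ∘ᵢ y, where x has arity
-- suc n and y has arity suc m (so x ∘ᵢ y has arity suc (n + m)).
-- All indices are 0-based.

-- inner i k : position of the k-th letter of the inserted block,
-- i.e. (0-based) i + k.
inner : ∀ {n m} → Fin (suc n) → Fin (suc m) → Fin (suc (n + m))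
inner {n} {m} zero k = Fin.cast (cong suc (+-comm m n)) (k ↑ˡ n)
inner {suc n} (suc i) k = suc (inner i k)

-- outer i j : for j ≢ i, position of the letter coming from x_j,
-- i.e. j if j < i, and j + m if j > i.  (The value for j = i is
-- irrelevant; it is set to the start of the block.)
outer : ∀ {n m} → Fin (suc n) → Fin (suc n) → Fin (suc (n + m))
outer zero zero = zero
outer {suc n} {m} zero (suc j) =
  Fin.cast (cong suc (+-comm m (suc n))) (suc m ↑ʳ j)
outer {suc n} (suc i) zero = zero
outer {suc n} (suc i) (suc j) = suc (outer i j)

-- Set-operads (symmetric, unital).  O n is the set of elements of
-- arity suc n (arities are ≥ 1).

record RawSetOperad : Set₁ where
  field
    O      : ℕ → Set
    𝟙      : O 0
    _∘[_]_ : ∀ {n m} → O n → Fin (suc n) → O m → O (n + m)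
    _·_    : ∀ {n} → O n → Permutation′ (suc n) → O n

swap-+ : ∀ n m k → n + m + k ≡ n + k + m
swap-+ n m k = trans (+-assoc n m k) (trans (cong (n +_) (+-comm m k)) (sym (+-assoc n k m)))

record IsSetOperad (P : RawSetOperad) : Set where
  open RawSetOperad P
  field
    -- sequential associativity: (x ∘ᵢ y) ∘_{i+j-1} z = x ∘ᵢ (y ∘ⱼ z)
    assoc-seq : ∀ {n m k} (x : O n) (y : O m) (z : O k)
                (i : Fin (suc n)) (j : Fin (suc m)) →
                subst O (+-assoc n m k) ((x ∘[ i ] y) ∘[ inner i j ] z)
                  ≡ x ∘[ i ] (y ∘[ j ] z)
    -- parallel associativity: for i < j,
    -- (x ∘ᵢ y) ∘_{j+|y|-1} z = (x ∘ⱼ z) ∘ᵢ y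
    assoc-par : ∀ {n m k} (x : O n) (y : O m) (z : O k)
                (i j : Fin (suc n)) → i < j →
                subst O (swap-+ n m k) ((x ∘[ i ] y) ∘[ outer i j ] z)
                  ≡ (x ∘[ j ] z) ∘[ outer j i ] y
    unit-left  : ∀ {m} (x : O m) → 𝟙 ∘[ zero ] x ≡ x
    unit-right : ∀ {n} (x : O n) (i : Fin (suc n)) →
                 subst O (+-identityʳ n) (x ∘[ i ] 𝟙) ≡ x
    act-id   : ∀ {n} (x : O n) → x · Perm.id ≡ x
    -- (x·σ)·τ = x·(στ), where (στ)(k) = σ(τ(k)), i.e. στ = τ ∘ₚ σ
    act-comp : ∀ {n} (x : O n) (σ τ : Permutation′ (suc n)) →
               (x · σ) · τ ≡ x · (τ ∘ₚ σ)
    -- equivariance: (x·σ) ∘ᵢ (y·τ) = (x ∘_{σ(i)} y) · (σ ∘ᵢ τ), where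
    -- σ ∘ᵢ τ is the block permutation, characterised by its values on
    -- all positions of the composite
    equivariance :
      ∀ {n m} (x : O n) (y : O m) (i : Fin (suc n))
        (σ : Permutation′ (suc n)) (τ : Permutation′ (suc m))
        (ρ : Permutation′ (suc (n + m))) →
        (∀ j → j ≢ i →
           ρ ⟨$⟩ʳ outer {n} {m} i j ≡ outer (σ ⟨$⟩ʳ i) (σ ⟨$⟩ʳ j)) →
        (∀ k → ρ ⟨$⟩ʳ inner i k ≡ inner (σ ⟨$⟩ʳ i) (τ ⟨$⟩ʳ k)) →
        (x · σ) ∘[ i ] (y · τ) ≡ (x ∘[ σ ⟨$⟩ʳ i ] y) · ρ

record IsOperadMorphism (P Q : RawSetOperad) 
       (f : ∀ {n} → RawSetOperad.O P n → RawSetOperad.O Q n) : Set where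
  private
    module P = RawSetOperad P
    module Q = RawSetOperad Q
  field
    pres-𝟙 : f P.𝟙 ≡ Q.𝟙
    pres-∘ : ∀ {n m} (x : P.O n) (i : Fin (suc n)) (y : P.O m) →
             f (x P.∘[ i ] y) ≡ f x Q.∘[ i ] f y
    pres-· : ∀ {n} (x : P.O n) (σ : Permutation′ (suc n)) →
             f (x P.· σ) ≡ f x Q.· σ

module _ (M : SetMonoid) where
  open SetMonoid M renaming (Carrier to A)

  TO : ℕ → Set
  TO n = Vec A (suc n)

  T𝟙 : TO 0
  T𝟙 = ε ∷ []

  T∘ : ∀ {n m} → TO n → Fin (suc n) → TO m → TO (n + m)
  T∘ {n} {m} (x ∷ xs) zero y =
    Vec.cast (cong suc (+-comm m n)) (Vec.map (x ∙_) y ++ xs)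
  T∘ {suc n} (x ∷ xs) (suc i) y = x ∷ T∘ xs i y

  T· : ∀ {n} → TO n → Permutation′ (suc n) → TO n
  T· x σ = tabulate (λ k → lookup x (σ ⟨$⟩ʳ k))

  T : RawSetOperad
  T = record { O = TO ; 𝟙 = T𝟙 ; _∘[_]_ = T∘ ; _·_ = T· }

Tmap : {M N : SetMonoid} → (Carrier M → Carrier N) →
       ∀ {n} → RawSetOperad.O (T M) n → RawSetOperad.O (T N) n
Tmap θ = Vec.map θ

module Submission where

open import Defs
open import Data.Product using (_×_)
open import Data.Nat using (ℕ)
open import Relation.Binary.PropositionalEquality using (_≡_)
open import Function using (id; _∘_)
open import Function.Definitions using (Injective; Surjective)

open import Data.Nat using (zero; suc; _+_; s≤s)
import Data.Nat as ℕ
open import Data.Nat.Properties using (+-suc; +-comm; +-assoc; +-identityʳ)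
open import Data.Fin as Fin using (Fin; zero; suc; toℕ; _↑ˡ_; _↑ʳ_; splitAt)
open import Data.Fin.Properties
  using (toℕ-cast; toℕ-↑ˡ; toℕ-↑ʳ; toℕ<n; cast-involutive; splitAt⁻¹-↑ˡ; splitAt⁻¹-↑ʳ; suc-injective)
open import Data.Fin.Permutation as Perm using (Permutation′; _⟨$⟩ʳ_; _⟨$⟩ˡ_; inverseˡ)
open import Data.List as List using (List; []; _∷_; _++_; length)
import Data.List.Properties as List
open import Data.Vec as Vec using ([]; _∷_; lookup; toList)
import Data.Vec.Properties as Vec
open import Data.Product using (Σ; _,_; proj₁; proj₂)
open import Data.Sum using (_⊎_; inj₁; inj₂)
open import Data.Empty using (⊥-elim)
open import Relation.Binary.PropositionalEquality
  using (refl; sym; trans; cong; cong₂; subst; _≢_; module ≡-Reasoning)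
open import Algebra.Core using (Op₂)
open import Algebra.Structures using (IsMonoid)
open import Algebra.Morphism.Structures using (module MonoidMorphisms)
open import Function.Consequences.Propositional using (strictlySurjective⇒surjective)

--  * Partial compositions are studied on lists.  'graft' is the list
--    version of ∘ᵢ (with a numeric position), and toList turns T∘ into
--    'graft'.  Both associativity axioms and both unit axioms become list
--    identities proved by induction on the position, using associativity
--    and unitality of the monoid; the only index arithmetic needed is the
--    numeric value of the positions 'inner' and 'outer' used in the axioms.
--    Naturality of 'graft' under maps also gives that T θ preserves ∘ᵢ.
--  * The symmetric group actions are studied through 'lookup': the action
--    law, equivariance and preservation of the action by T θ are checked
--    letter by letter, where equivariance uses that every position of
--    x ∘ᵢ y lies either in the inserted block or outside it.

cast-split : ∀ {a b c} .(eq : a + b ≡ c) (p : Fin c) →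
             (Σ (Fin a) λ k → Fin.cast eq (k ↑ˡ b) ≡ p) ⊎
             (Σ (Fin b) λ j → Fin.cast eq (a ↑ʳ j) ≡ p)
cast-split {a} {b} eq p with splitAt a (Fin.cast (sym eq) p) in split
... | inj₁ k = inj₁ (k , trans (cong (Fin.cast eq) (splitAt⁻¹-↑ˡ split))
                               (cast-involutive eq (sym eq) p))
... | inj₂ j = inj₂ (j , trans (cong (Fin.cast eq) (splitAt⁻¹-↑ʳ split))
                               (cast-involutive eq (sym eq) p))

cover : ∀ {n m} (i : Fin (suc n)) (p : Fin (suc (n + m))) →
        (Σ (Fin (suc m)) λ k → inner i k ≡ p) ⊎
        (Σ (Fin (suc n)) λ j → (j ≢ i) × (outer {n} {m} i j ≡ p))
cover {zero} {m} zero p with cast-split (cong suc (+-comm m zero)) p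
... | inj₁ (k , e) = inj₁ (k , e)
... | inj₂ (() , _)
cover {suc n} {m} zero p with cast-split (cong suc (+-comm m (suc n))) p
... | inj₁ (k , e) = inj₁ (k , e)
... | inj₂ (j , e) = inj₂ (suc j , (λ ()) , e)
cover {suc n} (suc i) zero = inj₂ (zero , (λ ()) , refl)
cover {suc n} (suc i) (suc p) with cover i p
... | inj₁ (k , e) = inj₁ (k , cong suc e)
... | inj₂ (j , j≢i , e) = inj₂ (suc j , (λ q → j≢i (suc-injective q)) , cong suc e)

toℕ-inner : ∀ {n m} (i : Fin (suc n)) (k : Fin (suc m)) →
            toℕ (inner i k) ≡ toℕ i + toℕ k
toℕ-inner {n} zero k = trans (toℕ-cast _ (k ↑ˡ n)) (toℕ-↑ˡ k n)
toℕ-inner {suc n} (suc i) k = cong suc (toℕ-inner i k)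

toℕ-outer-< : ∀ {n m} (i j : Fin (suc n)) → toℕ j ℕ.< toℕ i →
              toℕ (outer {n} {m} i j) ≡ toℕ j
toℕ-outer-< {suc n} (suc i) zero _ = refl
toℕ-outer-< {suc n} (suc i) (suc j) (s≤s j<i) = cong suc (toℕ-outer-< i j j<i)

toℕ-outer-> : ∀ {n m} (i j : Fin (suc n)) → toℕ i ℕ.< toℕ j →
              toℕ (outer {n} {m} i j) ≡ m + toℕ j
toℕ-outer-> {suc n} {m} zero (suc j) _ = begin
  toℕ (Fin.cast eq (suc m ↑ʳ j)) ≡⟨ toℕ-cast eq (suc m ↑ʳ j) ⟩
  toℕ (suc m ↑ʳ j)              ≡⟨ toℕ-↑ʳ (suc m) j ⟩
  suc m + toℕ j                 ≡⟨ +-suc m (toℕ j) ⟨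
  m + suc (toℕ j)               ∎
  where
  open ≡-Reasoning
  eq : suc (m + suc n) ≡ suc (suc n + m)
  eq = cong suc (+-comm m (suc n))
toℕ-outer-> {suc n} {m} (suc i) (suc j) (s≤s i<j) =
  trans (cong suc (toℕ-outer-> i j i<j)) (sym (+-suc m (toℕ j)))

graft : {A : Set} → Op₂ A → List A → ℕ → List A → List A
graft _∙_ []       i       ys = []
graft _∙_ (a ∷ as) zero    ys = List.map (a ∙_) ys ++ as
graft _∙_ (a ∷ as) (suc i) ys = a ∷ graft _∙_ as i ys

module _ {A : Set} (_∙_ : Op₂ A) where

  graft-++ˡ : ∀ us vs {i} zs → i ℕ.< length us →
              graft _∙_ (us ++ vs) i zs ≡ graft _∙_ us i zs ++ vs
  graft-++ˡ (u ∷ us) vs {zero}  zs _         = sym (List.++-assoc (List.map (u ∙_) zs) us vs)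
  graft-++ˡ (u ∷ us) vs {suc i} zs (s≤s i<) = cong (u ∷_) (graft-++ˡ us vs zs i<)

  graft-++ʳ : ∀ us vs j zs →
              graft _∙_ (us ++ vs) (length us + j) zs ≡ us ++ graft _∙_ vs j zs
  graft-++ʳ []       vs j zs = refl
  graft-++ʳ (u ∷ us) vs j zs = cong (u ∷_) (graft-++ʳ us vs j zs)

-- Naturality: maps θ, ψ with θ (a ∙ b) = θ a ∙' ψ b commute with grafting.
-- This gives both associativity (θ = a∙_, ψ = id) and the fact that
-- monoid morphisms preserve grafting (θ = ψ).
graft-map : ∀ {A B : Set} (_∙_ : Op₂ A) (_∙′_ : Op₂ B) (θ ψ : A → B) →
            (∀ a b → θ (a ∙ b) ≡ θ a ∙′ ψ b) → ∀ xs i ys →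
            List.map θ (graft _∙_ xs i ys)
              ≡ graft _∙′_ (List.map θ xs) i (List.map ψ ys)
graft-map _∙_ _∙′_ θ ψ hom []       i       ys = refl
graft-map _∙_ _∙′_ θ ψ hom (a ∷ as) (suc i) ys =
  cong (θ a ∷_) (graft-map _∙_ _∙′_ θ ψ hom as i ys)
graft-map _∙_ _∙′_ θ ψ hom (a ∷ as) zero    ys = begin
  List.map θ (List.map (a ∙_) ys ++ as)
    ≡⟨ List.map-++ θ (List.map (a ∙_) ys) as ⟩
  List.map θ (List.map (a ∙_) ys) ++ List.map θ as
    ≡⟨ cong (_++ List.map θ as) block ⟩
  List.map (θ a ∙′_) (List.map ψ ys) ++ List.map θ as ∎
  where
  open ≡-Reasoning
  block : List.map θ (List.map (a ∙_) ys) ≡ List.map (θ a ∙′_) (List.map ψ ys)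
  block = trans (sym (List.map-∘ ys))
                (trans (List.map-cong (hom a) ys) (List.map-∘ ys))

module GraftLaws (M : SetMonoid) where
  open SetMonoid M renaming (Carrier to A) using (_∙_; ε; isMonoid)
  open IsMonoid isMonoid using (assoc; identityˡ; identityʳ)

  graft-unitˡ : ∀ ys → graft _∙_ (ε ∷ []) zero ys ≡ ys
  graft-unitˡ ys = trans (List.++-identityʳ _)
                         (trans (List.map-cong identityˡ ys) (List.map-id ys))

  graft-unitʳ : ∀ xs i → graft _∙_ xs i (ε ∷ []) ≡ xs
  graft-unitʳ []       i       = refl
  graft-unitʳ (a ∷ as) zero    = cong (_∷ as) (identityʳ a)
  graft-unitʳ (a ∷ as) (suc i) = cong (a ∷_) (graft-unitʳ as i)

  graft-assoc-seq : ∀ xs i ys {j} zs → j ℕ.< length ys →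
                    graft _∙_ (graft _∙_ xs i ys) (i + j) zs
                      ≡ graft _∙_ xs i (graft _∙_ ys j zs)
  graft-assoc-seq []       i       ys zs _ = refl
  graft-assoc-seq (a ∷ as) (suc i) ys zs j< = cong (a ∷_) (graft-assoc-seq as i ys zs j<)
  graft-assoc-seq (a ∷ as) zero    ys {j} zs j< = begin
    graft _∙_ (List.map (a ∙_) ys ++ as) j zs
      ≡⟨ graft-++ˡ _∙_ (List.map (a ∙_) ys) as zs
           (subst (j ℕ.<_) (sym (List.length-map (a ∙_) ys)) j<) ⟩
    graft _∙_ (List.map (a ∙_) ys) j zs ++ as
      ≡⟨ cong (λ zs′ → graft _∙_ (List.map (a ∙_) ys) j zs′ ++ as) (List.map-id zs) ⟨
    graft _∙_ (List.map (a ∙_) ys) j (List.map id zs) ++ as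
      ≡⟨ cong (_++ as) (graft-map _∙_ _∙_ (a ∙_) id (λ b c → sym (assoc a b c)) ys j zs) ⟨
    List.map (a ∙_) (graft _∙_ ys j zs) ++ as ∎
    where open ≡-Reasoning

  graft-assoc-par : ∀ xs {i j} y ys zs → i ℕ.< j →
                    graft _∙_ (graft _∙_ xs i (y ∷ ys)) (length ys + j) zs
                      ≡ graft _∙_ (graft _∙_ xs j zs) i (y ∷ ys)
  graft-assoc-par []       y ys zs _ = refl
  graft-assoc-par (a ∷ as) {zero} {suc j} y ys zs _ = begin
    graft _∙_ (block ++ as) (length ys + suc j) zs
      ≡⟨ cong (λ p → graft _∙_ (block ++ as) p zs) shift ⟩
    graft _∙_ (block ++ as) (length block + j) zs
      ≡⟨ graft-++ʳ _∙_ block as j zs ⟩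
    block ++ graft _∙_ as j zs ∎
    where
    open ≡-Reasoning
    block : List A
    block = List.map (a ∙_) (y ∷ ys)
    shift : length ys + suc j ≡ length block + j
    shift = trans (+-suc (length ys) j) (cong (λ l → suc (l + j)) (sym (List.length-map (a ∙_) ys)))
  graft-assoc-par (a ∷ as) {suc i} {suc j} y ys zs (s≤s i<j) = begin
    graft _∙_ (a ∷ graft _∙_ as i (y ∷ ys)) (length ys + suc j) zs
      ≡⟨ cong (λ p → graft _∙_ (a ∷ graft _∙_ as i (y ∷ ys)) p zs) (+-suc (length ys) j) ⟩
    a ∷ graft _∙_ (graft _∙_ as i (y ∷ ys)) (length ys + j) zs
      ≡⟨ cong (a ∷_) (graft-assoc-par as y ys zs i<j) ⟩
    a ∷ graft _∙_ (graft _∙_ as j zs) i (y ∷ ys) ∎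
    where open ≡-Reasoning

module TOperad (M : SetMonoid) where
  open SetMonoid M using (_∙_)
  open GraftLaws M
  open RawSetOperad (T M) using (O; _∘[_]_; _·_)

  word-ext : ∀ {a b} (eq : a ≡ b) (u : O a) (v : O b) →
             toList u ≡ toList v → subst O eq u ≡ v
  word-ext refl u v h = trans (sym (Vec.cast-is-id refl u)) (Vec.toList-injective refl u v h)

  toList-∘ : ∀ {n m} (x : O n) (i : Fin (suc n)) (y : O m) →
             toList (x ∘[ i ] y) ≡ graft _∙_ (toList x) (toℕ i) (toList y)
  toList-∘ {n} {m} (a ∷ as) zero y = begin
    toList (Vec.cast _ (Vec.map (a ∙_) y Vec.++ as))
      ≡⟨ Vec.toList-cast _ (Vec.map (a ∙_) y Vec.++ as) ⟩
    toList (Vec.map (a ∙_) y Vec.++ as)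
      ≡⟨ Vec.toList-++ (Vec.map (a ∙_) y) as ⟩
    toList (Vec.map (a ∙_) y) ++ toList as
      ≡⟨ cong (_++ toList as) (Vec.toList-map (a ∙_) y) ⟩
    List.map (a ∙_) (toList y) ++ toList as ∎
    where open ≡-Reasoning
  toList-∘ {suc n} (a ∷ as) (suc i) y = cong (a ∷_) (toList-∘ as i y)

  unit-left : ∀ {m} (x : O m) → T𝟙 M ∘[ zero ] x ≡ x
  unit-left x = word-ext refl _ x (trans (toList-∘ (T𝟙 M) zero x) (graft-unitˡ (toList x)))

  unit-right : ∀ {n} (x : O n) (i : Fin (suc n)) →
               subst O (+-identityʳ n) (x ∘[ i ] T𝟙 M) ≡ x
  unit-right x i = word-ext _ _ x (trans (toList-∘ x i (T𝟙 M)) (graft-unitʳ (toList x) (toℕ i)))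

  assoc-seq : ∀ {n m k} (x : O n) (y : O m) (z : O k)
              (i : Fin (suc n)) (j : Fin (suc m)) →
              subst O (+-assoc n m k) ((x ∘[ i ] y) ∘[ inner i j ] z)
                ≡ x ∘[ i ] (y ∘[ j ] z)
  assoc-seq x y z i j = word-ext _ _ _ (begin
    toList ((x ∘[ i ] y) ∘[ inner i j ] z)
      ≡⟨ toList-∘ (x ∘[ i ] y) (inner i j) z ⟩
    graft _∙_ (toList (x ∘[ i ] y)) (toℕ (inner i j)) (toList z)
      ≡⟨ cong₂ (λ xy p → graft _∙_ xy p (toList z)) (toList-∘ x i y) (toℕ-inner i j) ⟩
    graft _∙_ (graft _∙_ (toList x) (toℕ i) (toList y)) (toℕ i + toℕ j) (toList z)
      ≡⟨ graft-assoc-seq (toList x) (toℕ i) (toList y) (toList z)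
           (subst (toℕ j ℕ.<_) (sym (Vec.length-toList y)) (toℕ<n j)) ⟩
    graft _∙_ (toList x) (toℕ i) (graft _∙_ (toList y) (toℕ j) (toList z))
      ≡⟨ cong (graft _∙_ (toList x) (toℕ i)) (toList-∘ y j z) ⟨
    graft _∙_ (toList x) (toℕ i) (toList (y ∘[ j ] z))
      ≡⟨ toList-∘ x i (y ∘[ j ] z) ⟨
    toList (x ∘[ i ] (y ∘[ j ] z)) ∎)
    where open ≡-Reasoning

  assoc-par : ∀ {n m k} (x : O n) (y : O m) (z : O k)
              (i j : Fin (suc n)) → i Fin.< j →
              subst O (swap-+ n m k) ((x ∘[ i ] y) ∘[ outer i j ] z)
                ≡ (x ∘[ j ] z) ∘[ outer j i ] y
  assoc-par {m = m} x (b ∷ bs) z i j i<j = word-ext _ _ _ (begin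
    toList ((x ∘[ i ] y) ∘[ outer i j ] z)
      ≡⟨ toList-∘ (x ∘[ i ] y) (outer i j) z ⟩
    graft _∙_ (toList (x ∘[ i ] y)) (toℕ (outer i j)) (toList z)
      ≡⟨ cong₂ (λ xy p → graft _∙_ xy p (toList z)) (toList-∘ x i y) position-j ⟩
    graft _∙_ (graft _∙_ (toList x) (toℕ i) (toList y)) (length (toList bs) + toℕ j) (toList z)
      ≡⟨ graft-assoc-par (toList x) b (toList bs) (toList z) i<j ⟩
    graft _∙_ (graft _∙_ (toList x) (toℕ j) (toList z)) (toℕ i) (toList y)
      ≡⟨ cong₂ (λ xz p → graft _∙_ xz p (toList y)) (toList-∘ x j z) (toℕ-outer-< j i i<j) ⟨
    graft _∙_ (toList (x ∘[ j ] z)) (toℕ (outer j i)) (toList y)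
      ≡⟨ toList-∘ (x ∘[ j ] z) (outer j i) y ⟨
    toList ((x ∘[ j ] z) ∘[ outer j i ] y) ∎)
    where
    open ≡-Reasoning
    y : O m
    y = b ∷ bs
    position-j : toℕ (outer {m = m} i j) ≡ length (toList bs) + toℕ j
    position-j = trans (toℕ-outer-> i j i<j) (cong (_+ toℕ j) (sym (Vec.length-toList bs)))

  lookup-inner : ∀ {n m} (x : O n) (i : Fin (suc n)) (y : O m) (k : Fin (suc m)) →
                 lookup (x ∘[ i ] y) (inner i k) ≡ lookup x i ∙ lookup y k
  lookup-inner {n} {m} (a ∷ as) zero y k =
    trans (Vec.lookup-cast (cong suc (+-comm m n)) (Vec.map (a ∙_) y Vec.++ as) (k ↑ˡ n))
      (trans (Vec.lookup-++ˡ (Vec.map (a ∙_) y) as k) (Vec.lookup-map k (a ∙_) y))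
  lookup-inner {suc n} (a ∷ as) (suc i) y k = lookup-inner as i y k

  lookup-outer : ∀ {n m} (x : O n) (i j : Fin (suc n)) (y : O m) → j ≢ i →
                 lookup (x ∘[ i ] y) (outer i j) ≡ lookup x j
  lookup-outer x zero zero y j≢i = ⊥-elim (j≢i refl)
  lookup-outer {suc n} {m} (a ∷ as) zero (suc j) y _ =
    trans (Vec.lookup-cast (cong suc (+-comm m (suc n))) (Vec.map (a ∙_) y Vec.++ as) (suc m ↑ʳ j))
      (Vec.lookup-++ʳ (Vec.map (a ∙_) y) as j)
  lookup-outer {suc n} (a ∷ as) (suc i) zero y _ = refl
  lookup-outer {suc n} (a ∷ as) (suc i) (suc j) y j≢i =
    lookup-outer as i j y (λ e → j≢i (cong suc e))

  lookup-· : ∀ {n} (x : O n) (σ : Permutation′ (suc n)) k →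
             lookup (x · σ) k ≡ lookup x (σ ⟨$⟩ʳ k)
  lookup-· x σ = Vec.lookup∘tabulate (λ q → lookup x (σ ⟨$⟩ʳ q))

  lookup-ext : ∀ {n} {u v : O n} → (∀ p → lookup u p ≡ lookup v p) → u ≡ v
  lookup-ext {u = u} {v} h =
    trans (sym (Vec.tabulate∘lookup u)) (trans (Vec.tabulate-cong h) (Vec.tabulate∘lookup v))

  permutation-injective : ∀ {n} (σ : Permutation′ n) {a b} → σ ⟨$⟩ʳ a ≡ σ ⟨$⟩ʳ b → a ≡ b
  permutation-injective σ e = trans (sym (inverseˡ σ)) (trans (cong (σ ⟨$⟩ˡ_) e) (inverseˡ σ))

  act-id : ∀ {n} (x : O n) → x · Perm.id ≡ x
  act-id x = Vec.tabulate∘lookup x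

  act-comp : ∀ {n} (x : O n) (σ τ : Permutation′ (suc n)) →
             (x · σ) · τ ≡ x · (τ Perm.∘ₚ σ)
  act-comp x σ τ = Vec.tabulate-cong λ k → lookup-· x σ (τ ⟨$⟩ʳ k)

  equivariance :
      ∀ {n m} (x : O n) (y : O m) (i : Fin (suc n))
        (σ : Permutation′ (suc n)) (τ : Permutation′ (suc m))
        (ρ : Permutation′ (suc (n + m))) →
        (∀ j → j ≢ i →
           ρ ⟨$⟩ʳ outer {n} {m} i j ≡ outer (σ ⟨$⟩ʳ i) (σ ⟨$⟩ʳ j)) →
        (∀ k → ρ ⟨$⟩ʳ inner i k ≡ inner (σ ⟨$⟩ʳ i) (τ ⟨$⟩ʳ k)) →
        (x · σ) ∘[ i ] (y · τ) ≡ (x ∘[ σ ⟨$⟩ʳ i ] y) · ρ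
  equivariance {n} {m} x y i σ τ ρ ρ-outer ρ-inner = lookup-ext letter
    where
    open ≡-Reasoning
    xy : O (n + m)
    xy = x ∘[ σ ⟨$⟩ʳ i ] y
    letter : ∀ p → lookup ((x · σ) ∘[ i ] (y · τ)) p ≡ lookup (xy · ρ) p
    letter p with cover {n} {m} i p
    ... | inj₁ (k , refl) = begin
      lookup ((x · σ) ∘[ i ] (y · τ)) (inner i k)  ≡⟨ lookup-inner (x · σ) i (y · τ) k ⟩
      lookup (x · σ) i ∙ lookup (y · τ) k         ≡⟨ cong₂ _∙_ (lookup-· x σ i) (lookup-· y τ k) ⟩
      lookup x (σ ⟨$⟩ʳ i) ∙ lookup y (τ ⟨$⟩ʳ k)   ≡⟨ lookup-inner x (σ ⟨$⟩ʳ i) y (τ ⟨$⟩ʳ k) ⟨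
      lookup xy (inner (σ ⟨$⟩ʳ i) (τ ⟨$⟩ʳ k))     ≡⟨ cong (lookup xy) (ρ-inner k) ⟨
      lookup xy (ρ ⟨$⟩ʳ inner i k)               ≡⟨ lookup-· xy ρ (inner i k) ⟨
      lookup (xy · ρ) (inner i k)                ∎
    ... | inj₂ (j , j≢i , refl) = begin
      lookup ((x · σ) ∘[ i ] (y · τ)) (outer i j)  ≡⟨ lookup-outer (x · σ) i j (y · τ) j≢i ⟩
      lookup (x · σ) j                            ≡⟨ lookup-· x σ j ⟩
      lookup x (σ ⟨$⟩ʳ j)                         ≡⟨ lookup-outer x (σ ⟨$⟩ʳ i) (σ ⟨$⟩ʳ j) y
                                                       (λ e → j≢i (permutation-injective σ e)) ⟨
      lookup xy (outer (σ ⟨$⟩ʳ i) (σ ⟨$⟩ʳ j))     ≡⟨ cong (lookup xy) (ρ-outer j j≢i) ⟨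
      lookup xy (ρ ⟨$⟩ʳ outer i j)               ≡⟨ lookup-· xy ρ (outer i j) ⟨
      lookup (xy · ρ) (outer i j)                ∎

  isSetOperad : IsSetOperad (T M)
  isSetOperad = record
    { assoc-seq = assoc-seq ; assoc-par = assoc-par
    ; unit-left = unit-left ; unit-right = unit-right
    ; act-id = act-id ; act-comp = act-comp ; equivariance = equivariance }

module TMorphism (M N : SetMonoid) (θ : SetMonoid.Carrier M → SetMonoid.Carrier N)
                 (θ-hom : IsMonoidMorphism M N θ) where
  open MonoidMorphisms.IsMonoidHomomorphism θ-hom using (homo; ε-homo)
  module M = TOperad M
  open SetMonoid M using () renaming (_∙_ to _∙₁_)
  open SetMonoid N using () renaming (_∙_ to _∙₂_)
  module N = TOperad N
  open RawSetOperad (T M) using () renaming (O to O₁; _∘[_]_ to _∘₁[_]_; _·_ to _·₁_)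
  open RawSetOperad (T N) using () renaming (_∘[_]_ to _∘₂[_]_; _·_ to _·₂_)

  -- Naturality of grafting, transported along toList.
  pres-∘ : ∀ {n m} (x : O₁ n) (i : Fin (suc n)) (y : O₁ m) →
           Tmap {M} {N} θ (x ∘₁[ i ] y) ≡ Tmap {M} {N} θ x ∘₂[ i ] Tmap {M} {N} θ y
  pres-∘ x i y = N.word-ext refl _ _ (begin
    toList (Vec.map θ (x ∘₁[ i ] y))
      ≡⟨ Vec.toList-map θ (x ∘₁[ i ] y) ⟩
    List.map θ (toList (x ∘₁[ i ] y))
      ≡⟨ cong (List.map θ) (M.toList-∘ x i y) ⟩
    List.map θ (graft _∙₁_ (toList x) (toℕ i) (toList y))
      ≡⟨ graft-map _∙₁_ _∙₂_ θ θ homo (toList x) (toℕ i) (toList y) ⟩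
    graft _∙₂_ (List.map θ (toList x)) (toℕ i) (List.map θ (toList y))
      ≡⟨ cong₂ (λ u v → graft _∙₂_ u (toℕ i) v) (Vec.toList-map θ x) (Vec.toList-map θ y) ⟨
    graft _∙₂_ (toList (Vec.map θ x)) (toℕ i) (toList (Vec.map θ y))
      ≡⟨ N.toList-∘ (Vec.map θ x) i (Vec.map θ y) ⟨
    toList (Vec.map θ x ∘₂[ i ] Vec.map θ y) ∎)
    where open ≡-Reasoning

  pres-· : ∀ {n} (x : O₁ n) (σ : Permutation′ (suc n)) →
           Tmap {M} {N} θ (x ·₁ σ) ≡ Tmap {M} {N} θ x ·₂ σ
  pres-· x σ = N.lookup-ext λ p → begin
    lookup (Vec.map θ (x ·₁ σ)) p  ≡⟨ Vec.lookup-map p θ (x ·₁ σ) ⟩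
    θ (lookup (x ·₁ σ) p)          ≡⟨ cong θ (M.lookup-· x σ p) ⟩
    θ (lookup x (σ ⟨$⟩ʳ p))        ≡⟨ Vec.lookup-map (σ ⟨$⟩ʳ p) θ x ⟨
    lookup (Vec.map θ x) (σ ⟨$⟩ʳ p) ≡⟨ N.lookup-· (Vec.map θ x) σ p ⟨
    lookup (Vec.map θ x ·₂ σ) p    ∎
    where open ≡-Reasoning

  isOperadMorphism : IsOperadMorphism (T M) (T N) (Tmap {M} {N} θ)
  isOperadMorphism = record { pres-𝟙 = cong (_∷ []) ε-homo ; pres-∘ = pres-∘ ; pres-· = pres-· }

map-injective : ∀ {A B : Set} {f : A → B} → Injective _≡_ _≡_ f →
                ∀ {n} → Injective _≡_ _≡_ (Vec.map {n = n} f)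
map-injective {f = f} f-inj {_} {u} {v} e = trans (sym (Vec.cast-is-id refl u))
  (Vec.toList-injective refl u v
    (List.map-injective f-inj
      (trans (sym (Vec.toList-map f u)) (trans (cong toList e) (Vec.toList-map f v)))))

-- A right inverse of f, applied letterwise, is a right inverse of map f.
map-surjective : ∀ {A B : Set} {f : A → B} → Surjective _≡_ _≡_ f →
                 ∀ {n} → Surjective _≡_ _≡_ (Vec.map {n = n} f)
map-surjective {A} {B} {f} f-surj = strictlySurjective⇒surjective λ v →
    Vec.map section v
  , trans (sym (Vec.map-∘ f section v)) (trans (Vec.map-cong section-inverse v) (Vec.map-id v))
  where
  section : B → A
  section b = proj₁ (f-surj b)
  section-inverse : ∀ b → f (section b) ≡ b
  section-inverse b = proj₂ (f-surj b) refl

mainTheorem1 :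
    -- T M is a set-operad
    ((M : SetMonoid) → IsSetOperad (T M))
    -- T θ is a morphism of set-operads
    × ((M N : SetMonoid) (θ : SetMonoid.Carrier M → SetMonoid.Carrier N) →
        IsMonoidMorphism M N θ → IsOperadMorphism (T M) (T N) (Tmap {M} {N} θ))
    -- functoriality: T id = id
    × ((M : SetMonoid) (n : ℕ) (x : RawSetOperad.O (T M) n) →
        Tmap {M} {M} id x ≡ x)
    -- functoriality: T (θ ∘ φ) = T θ ∘ T φ
    × ((M N P : SetMonoid)
        (φ : SetMonoid.Carrier M → SetMonoid.Carrier N)
        (θ : SetMonoid.Carrier N → SetMonoid.Carrier P) →
        IsMonoidMorphism M N φ → IsMonoidMorphism N P θ →
        (n : ℕ) (x : RawSetOperad.O (T M) n) →
        Tmap {M} {P} (θ ∘ φ) x ≡ Tmap {N} {P} θ (Tmap {M} {N} φ x))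
    -- T preserves injections
    × ((M N : SetMonoid) (θ : SetMonoid.Carrier M → SetMonoid.Carrier N) →
        IsMonoidMorphism M N θ → Injective _≡_ _≡_ θ →
        (n : ℕ) → Injective _≡_ _≡_ (Tmap {M} {N} θ {n}))
    -- T preserves surjections
    × ((M N : SetMonoid) (θ : SetMonoid.Carrier M → SetMonoid.Carrier N) →
        IsMonoidMorphism M N θ → Surjective _≡_ _≡_ θ →
        (n : ℕ) → Surjective _≡_ _≡_ (Tmap {M} {N} θ {n}))
mainTheorem1 =
    TOperad.isSetOperad
  , TMorphism.isOperadMorphism
  , (λ M n → Vec.map-id)
  , (λ M N P φ θ _ _ n → Vec.map-∘ θ φ)
  , (λ M N θ _ θ-inj n → map-injective θ-inj)
  , (λ M N θ _ θ-surj n → map-surjective θ-surj)
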